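{- Consider a population of $n$ agents, with $c_j$ agents in state $q_j$ for $j=1,\dots,|Q|$, and let $m$ be an integer with $2m\le n$. Consider the following procedure: first sample the vector $(D_1,\dots,D_{|Q|})$ of the numbers of agents in each state among $m$ agents drawn uniformly without replacement from the population (a multivariate hypergeometric sample), and remove these agents; then for $i=1,\dots,|Q|$ in turn, sample $(d_{i1},\dots,d_{i|Q|})$ as the numbers of agents in each state among $D_i$ agents drawn uniformly without replacement from the agents remaining at that moment, and remove them. Then the resulting matrix $D=(d_{ij})$ has the same distribution as the matrix whose $(i,j)$ entry counts the indices $t\in\{1,\dots,m\}$ with $a_{2t-1}$ in state $q_i$ and $a_{2t}$ in state $q_j$, where $a_1,\dots,a_{2m}$ are agents drawn uniformly at random without replacement from the population.
   Context: This is the batch step of the simulators: $D$ counts, for each ordered pair of states, the number of (initiator, responder) interactions among $m$ disjoint interacting pairs. -}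

module Defs where

open import Data.Nat as ℕ using (ℕ; zero; suc)
open import Data.Integer using (+_)
open import Data.Rational using (ℚ; _/_; 1ℚ; 0ℚ) renaming (_+_ to _+ℚ_; _*_ to _*ℚ_)
open import Data.Fin using (Fin; _≟_)
open import Data.List using (List; []; _∷_; length; map; concatMap; filter; foldr; allFin)
open import Data.Vec using (Vec; []; _∷_; tabulate)
open import Data.Vec.Properties using (≡-dec)
open import Data.Product using (_×_; _,_)
open import Relation.Nullary using (¬?; yes; no)
open import Relation.Binary.PropositionalEquality using (_≡_)
import Data.List.Membership.DecPropositional as DecMem

Dist : Set → Set
Dist A = List (ℚ × A)

return : {A : Set} → A → Dist A
return a = (1ℚ , a) ∷ []

_>>=_ : {A B : Set} → Dist A → (A → Dist B) → Dist B
d >>= f = concatMap (λ { (p , a) → map (λ { (q , b) → (p *ℚ q , b) }) (f a) }) d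

uniform : {A : Set} → List A → Dist A
uniform []         = []
uniform (x ∷ xs)   = map (λ y → ((+ 1) / suc (length xs) , y)) (x ∷ xs)

Matrix : ℕ → Set
Matrix k = Vec (Vec ℕ k) k

probOf : {k : ℕ} → Dist (Matrix k) → Matrix k → ℚ
probOf d M = foldr (λ { (p , X) acc → test X p acc }) 0ℚ d
  where
  test : _ → ℚ → ℚ → ℚ
  test X p acc with ≡-dec (≡-dec ℕ._≟_) X M
  ... | yes _ = p +ℚ acc
  ... | no  _ = acc

picks : {A : Set} → List A → List (A × List A)
picks []       = []
picks (x ∷ xs) = (x , xs) ∷ map (λ { (y , ys) → (y , x ∷ ys) }) (picks xs)

draws : {A : Set} → List A → ℕ → List (List A)
draws xs zero    = [] ∷ []
draws xs (suc r) = concatMap (λ { (x , rest) → map (x ∷_) (draws rest r) }) (picks xs)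

module Population {n k : ℕ} (st : Fin n → Fin k) where
  -- agents are Fin n; agent a is in state st a (states Q = Fin k)
  open DecMem (_≟_ {n}) using (_∈?_)

  countVec : List (Fin n) → Vec ℕ k
  countVec s = tabulate (λ j → length (filter (λ a → st a ≟ j) s))

  remove : List (Fin n) → List (Fin n) → List (Fin n)
  remove R s = filter (λ a → ¬? (a ∈? s)) R

  rowsStep : {k' : ℕ} → Vec ℕ k' → List (Fin n) → Dist (Vec (Vec ℕ k) k')
  rowsStep []       R = return []
  rowsStep (d ∷ Ds) R =
    uniform (draws R d) >>= λ s →
    rowsStep Ds (remove R s) >>= λ rest →
    return (countVec s ∷ rest)

  procedure : ℕ → Dist (Matrix k)
  procedure m =
    uniform (draws (allFin n) m) >>= λ s →
    rowsStep (countVec s) (remove (allFin n) s)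

  pairs : List (Fin n) → List (Fin n × Fin n)
  pairs (x ∷ y ∷ rest) = (x , y) ∷ pairs rest
  pairs _              = []

  pairMatrix : List (Fin n) → Matrix k
  pairMatrix a = tabulate (λ i → tabulate (λ j →
    length (filter (λ { (x , y) → st x ≟ i }) (filter (λ { (x , y) → st y ≟ j }) (pairs a)))))

  pairsDist : ℕ → Dist (Matrix k)
  pairsDist m = uniform (draws (allFin n) (2 ℕ.* m)) >>= λ a → return (pairMatrix a)

-- Both procedures weigh all their raw outcomes equally.  A raw outcome of the batch procedure is
-- a sequence s of m distinct initiators together with, for each state i, a sequence of distinct
-- fresh responders whose length is the number of initiators of s in state i; each has weight
-- 1/((n)_m (n-m)_m) = 1/(n)_{2m}, the weight of each sequence of 2m agents in the pair sampler.
-- Cutting such a sequence into (initiator, responder) pairs, keeping the initiators in order and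
-- grouping the responders by the state of their initiator, is a bijection between the raw
-- outcomes of the two procedures that turns the pair matrix into the matrix of state counts of
-- the responder groups.  Hence every matrix has equally many preimages on both sides.
module Submission where

open import Defs
open import Data.Nat as ℕ using (ℕ; zero; suc; _+_; _*_; _∸_; _≤_)
open import Data.Nat.Properties using (+-identityʳ; +-suc; *-assoc; *-zeroʳ; m+n∸m≡n)
import Data.Nat.Properties as ℕ
open import Data.Fin using (Fin; zero; suc; _≟_)
open import Data.List as List using (List; []; _∷_; _++_; map; concatMap; length; filter; head)
import Data.List.Properties as List
open import Data.List.Properties
  using (length-tabulate; filter-accept; filter-reject; map-id; length-++; length-map; map-∘;
         concatMap-map; map-concatMap; concatMap-cong)
open import Data.List.Membership.Propositional using (_∈_; _∉_; lose; find)
open import Data.List.Membership.Propositional.Properties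
  using (∈-allFin; ∈-filter⁻; ∈-filter⁺; ∈-++⁺ˡ; ∈-++⁺ʳ; ∈-++⁻; ∈-map⁺; ∈-map⁻; ∈-concatMap⁺; ∈-concatMap⁻)
open import Data.List.Membership.Propositional.Properties.WithK using (unique∧set⇒bag)
open import Data.List.Relation.Unary.Any using (here; there)
open import Data.List.Relation.Unary.All as All using (All; []; _∷_)
import Data.List.Relation.Unary.All.Properties as All
import Data.List.Relation.Unary.AllPairs as AllPairs
import Data.List.Relation.Unary.AllPairs.Properties as AllPairs
open import Data.List.Relation.Unary.Unique.Propositional using (Unique; []; _∷_)
import Data.List.Relation.Unary.Unique.Propositional.Properties as Unique
open import Data.List.Relation.Binary.Disjoint.Propositional using (Disjoint)
open import Data.List.Relation.Binary.Subset.Propositional using (_⊆_)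
open import Data.List.Relation.Binary.Permutation.Propositional
  using (_↭_; module PermutationReasoning; ↭-refl; ↭-reflexive; ↭-sym; ↭-trans; ↭-prep; ↭-swap; ↭⇒↭ₛ)
import Data.List.Relation.Binary.Permutation.Propositional.Properties as ↭
import Data.List.Relation.Binary.Permutation.Setoid.Properties as ↭ₛ
open import Data.List.Relation.Binary.BagAndSetEquality using (∼bag⇒↭)
open import Data.Maybe using (just)
import Data.Integer as ℤ
open import Data.Rational as ℚ using (ℚ; 0ℚ; 1ℚ)
import Data.Rational.Properties as ℚ
import Data.Rational.Unnormalised as ℚᵘ
import Data.Rational.Unnormalised.Properties as ℚᵘ
open import Algebra.Definitions.RawMonoid ℚ.+-0-rawMonoid using () renaming (_×_ to _·_)
open import Data.Vec as Vec using (Vec; []; _∷_; lookup; tabulate; _[_]%=_; _[_]≔_)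
open import Data.Vec.Properties
  using (≡-dec; ∷-injectiveˡ; ∷-injectiveʳ; toList-map; lookup-map; lookup-replicate; lookup∘tabulate;
         tabulate∘lookup; tabulate-cong; lookup∘updateAt; lookup∘updateAt′; updateAt-id; updateAt-updateAt;
         map-updateAt; []≔-lookup)
open import Data.Product using (_×_; _,_; proj₁; proj₂; ∃-syntax)
open import Data.Empty using (⊥-elim)
open import Data.Sum using ([_,_]′)
open import Function using (_∘_; id)
open import Relation.Nullary using (Dec; yes; no; does; ¬?)
open import Relation.Unary using (Decidable)
open import Data.Bool using (true; false)
open import Function.Bundles using (mk⇔)
open import Relation.Binary.PropositionalEquality
  using (_≡_; _≢_; refl; sym; trans; cong; cong₂; subst; setoid; module ≡-Reasoning)

private variable
  A B C : Set
  k : ℕ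
  x y : A
  xs ys : List A

Unique-resp-↭ : xs ↭ ys → Unique xs → Unique ys
Unique-resp-↭ p = ↭ₛ.Unique-resp-↭ (setoid _) (↭⇒↭ₛ p)

Unique-++⁻ : ∀ xs → Unique (xs ++ ys) → Unique xs × Unique ys × Disjoint xs ys
Unique-++⁻ []       u          = [] , u , λ ()
Unique-++⁻ (x ∷ xs) (x∉ ∷ u) with Unique-++⁻ xs u
... | uxs , uys , xs#ys = All.++⁻ˡ xs x∉ ∷ uxs , uys , λ
  { (here refl , z∈ys) → All.lookup (All.++⁻ʳ xs x∉) z∈ys refl
  ; (there z∈xs , z∈ys) → xs#ys (z∈xs , z∈ys) }

Unique-map⁺ : (f : A → B) → (∀ {x y} → x ∈ xs → y ∈ xs → f x ≡ f y → x ≡ y) →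
              Unique xs → Unique (map f xs)
Unique-map⁺ f inj []       = []
Unique-map⁺ f inj (x∉ ∷ u) =
  All.map⁺ (All.tabulate λ y∈ fx≡fy → All.lookup x∉ y∈ (inj (here refl) (there y∈) fx≡fy)) ∷
  Unique-map⁺ f (λ x∈ y∈ → inj (there x∈) (there y∈)) u

Unique-concatMap⁺ : {xs : List A} (f : A → List B) (g : A → C) (tag : B → C) →
                    (∀ {x z} → z ∈ f x → tag z ≡ g x) → Unique (map g xs) →
                    (∀ {x} → x ∈ xs → Unique (f x)) → Unique (concatMap f xs)
Unique-concatMap⁺ f g tag tag-f ug uf =
  Unique.concat⁺ (All.map⁺ (All.tabulate uf))
    (AllPairs.map⁺ (AllPairs.map disjoint (AllPairs.map⁻ ug)))
  where
  disjoint : ∀ {x y} → g x ≢ g y → Disjoint (f x) (f y)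
  disjoint gx≢gy (z∈fx , z∈fy) = gx≢gy (trans (sym (tag-f z∈fx)) (tag-f z∈fy))

unique∧set⇒↭ : Unique xs → Unique ys → xs ⊆ ys → ys ⊆ xs → xs ↭ ys
unique∧set⇒↭ uxs uys xs⊆ys ys⊆xs = ∼bag⇒↭ (unique∧set⇒bag uxs uys (mk⇔ xs⊆ys ys⊆xs))

∈-concatMap⁻′ : (f : A → List B) (xs : List A) {z : B} → z ∈ concatMap f xs → ∃[ x ] x ∈ xs × z ∈ f x
∈-concatMap⁻′ f xs z∈ = find (∈-concatMap⁻ f z∈)

∈-concatMap⁺′ : (f : A → List B) {z : B} → x ∈ xs → z ∈ f x → z ∈ concatMap f xs
∈-concatMap⁺′ f x∈ z∈ = ∈-concatMap⁺ f (lose x∈ z∈)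

length-concatMap-const : (f : A → List B) {c : ℕ} → (∀ {x} → x ∈ xs → length (f x) ≡ c) →
                         length (concatMap f xs) ≡ length xs * c
length-concatMap-const {xs = []}     f len-f = refl
length-concatMap-const {xs = x ∷ xs} f len-f =
  trans (length-++ (f x)) (cong₂ _+_ (len-f (here refl)) (length-concatMap-const f (len-f ∘ there)))

module _ {P : A → Set} (P? : Decidable P) where

  filter-map : (f : B → A) (xs : List B) → filter P? (map f xs) ≡ map f (filter (P? ∘ f) xs)
  filter-map f []       = refl
  filter-map f (x ∷ xs) with does (P? (f x))
  ... | true  = cong (f x ∷_) (filter-map f xs)
  ... | false = filter-map f xs

  filter-comm : {Q : A → Set} (Q? : Decidable Q) (xs : List A) → filter P? (filter Q? xs) ≡ filter Q? (filter P? xs)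
  filter-comm Q? []       = refl
  filter-comm Q? (x ∷ xs) with P? x | Q? x
  ... | yes px | yes qx =
    trans (filter-accept P? px) (trans (cong (x ∷_) (filter-comm Q? xs)) (sym (filter-accept Q? qx)))
  ... | yes px | no ¬qx = trans (filter-comm Q? xs) (sym (filter-reject Q? ¬qx))
  ... | no ¬px | yes qx = trans (filter-reject P? ¬px) (filter-comm Q? xs)
  ... | no ¬px | no ¬qx = filter-comm Q? xs

length≡0⇒[] : length xs ≡ 0 → xs ≡ []
length≡0⇒[] {xs = []} _ = refl

unpairs : List (A × A) → List A
unpairs []            = []
unpairs ((x , y) ∷ P) = x ∷ y ∷ unpairs P

unpairs-↭ : (P : List (A × A)) → unpairs P ↭ map proj₁ P ++ map proj₂ P
unpairs-↭ []            = ↭-refl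
unpairs-↭ ((x , y) ∷ P) =
  ↭-prep x (↭-trans (↭-prep y (unpairs-↭ P)) (↭-sym (↭.shift y (map proj₁ P) (map proj₂ P))))

length-unpairs : (P : List (A × A)) → length (unpairs P) ≡ length P + length P
length-unpairs []            = refl
length-unpairs ((x , y) ∷ P) = cong suc (trans (cong suc (length-unpairs P)) (sym (+-suc (length P) (length P))))

flatten : Vec (List A) k → List A
flatten = List.concat ∘ Vec.toList

lookup-ext : {u v : Vec A k} → (∀ i → lookup u i ≡ lookup v i) → u ≡ v
lookup-ext {u = u} {v} u≗v = trans (sym (tabulate∘lookup u)) (trans (tabulate-cong u≗v) (tabulate∘lookup v))

length-lookup : {v : Vec (List A) k} {c : Vec ℕ k} → Vec.map length v ≡ c → ∀ i → length (lookup v i) ≡ lookup c i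
length-lookup {v = v} lens i = trans (sym (lookup-map i length v)) (cong (λ c → lookup c i) lens)

flatten-[]%=∷ : (v : Vec (List A) k) (i : Fin k) → flatten (v [ i ]%= (x ∷_)) ↭ x ∷ flatten v
flatten-[]%=∷ (l ∷ v) zero    = ↭-refl
flatten-[]%=∷ {x = x} (l ∷ v) (suc i) =
  ↭-trans (↭.++⁺ˡ l (flatten-[]%=∷ v i)) (↭.shift x l (flatten v))

sum-map-length : (v : Vec (List A) k) → Vec.sum (Vec.map length v) ≡ length (flatten v)
sum-map-length []      = refl
sum-map-length (l ∷ v) = trans (cong (length l +_) (sum-map-length v)) (sym (length-++ l))

flatten-replicate : ∀ k → flatten {A = A} (Vec.replicate k []) ≡ []
flatten-replicate zero    = refl
flatten-replicate (suc k) = flatten-replicate k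

[]%=∷-injective : (v w : Vec (List A) k) (i : Fin k) → v [ i ]%= (x ∷_) ≡ w [ i ]%= (y ∷_) → x ≡ y × v ≡ w
[]%=∷-injective {x = x} {y = y} v w i eq =
  List.∷-injectiveˡ (trans (sym (lookup∘updateAt i v)) (trans (cong (λ u → lookup u i) eq) (lookup∘updateAt i w))) ,
  (begin
    v                                  ≡⟨ updateAt-id i v ⟨
    v [ i ]%= id                       ≡⟨ updateAt-updateAt i v ⟨
    v [ i ]%= (x ∷_) [ i ]%= List.drop 1 ≡⟨ cong (_[ i ]%= List.drop 1) eq ⟩
    w [ i ]%= (y ∷_) [ i ]%= List.drop 1 ≡⟨ updateAt-updateAt i w ⟩
    w [ i ]%= id                       ≡⟨ updateAt-id i w ⟩
    w                                  ∎)
  where open ≡-Reasoning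

module _ {k : ℕ} (key : A → Fin k) where

  buckets : List A → Vec (List A) k
  buckets []       = Vec.replicate k []
  buckets (x ∷ xs) = buckets xs [ key x ]%= (x ∷_)

  lookup-buckets : ∀ xs i → lookup (buckets xs) i ≡ filter ((_≟ i) ∘ key) xs
  lookup-buckets []       i = lookup-replicate i []
  lookup-buckets (x ∷ xs) i with key x ≟ i
  ... | yes refl = trans (lookup∘updateAt (key x) (buckets xs)) (cong (x ∷_) (lookup-buckets xs (key x)))
  ... | no  x≢i  = trans (lookup∘updateAt′ i (key x) (x≢i ∘ sym) (buckets xs)) (lookup-buckets xs i)

  flatten-buckets : ∀ xs → flatten (buckets xs) ↭ xs
  flatten-buckets []       = ↭-reflexive (flatten-replicate k)
  flatten-buckets (x ∷ xs) = ↭-trans (flatten-[]%=∷ (buckets xs) (key x)) (↭-prep x (flatten-buckets xs))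

-- Drawing without replacement

picks-↭ : {xs ys : List A} → (y , ys) ∈ picks xs → xs ↭ y ∷ ys
picks-↭ {xs = x ∷ xs} (here refl) = ↭-refl
picks-↭ {xs = x ∷ xs} (there p∈) with ∈-map⁻ (λ p → proj₁ p , x ∷ proj₂ p) p∈
... | (y , ys) , p∈′ , refl = ↭-trans (↭-prep x (picks-↭ p∈′)) (↭-swap x y ↭-refl)

∈-picks : y ∈ xs → ∃[ ys ] (y , ys) ∈ picks xs
∈-picks {xs = x ∷ xs} (here refl) = xs , here refl
∈-picks {xs = x ∷ xs} (there y∈) with ∈-picks y∈
... | ys , p∈ = x ∷ ys , there (∈-map⁺ (λ p → proj₁ p , x ∷ proj₂ p) p∈)

map-proj₁-picks : (xs : List A) → map proj₁ (picks xs) ≡ xs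
map-proj₁-picks []       = refl
map-proj₁-picks (x ∷ xs) = cong (x ∷_) (trans (sym (map-∘ (picks xs))) (map-proj₁-picks xs))

IsDraw : List A → ℕ → List A → Set
IsDraw xs r t = length t ≡ r × Unique t × t ⊆ xs

∈-draws⁻ : Unique xs → ∀ {r t} → t ∈ draws xs r → IsDraw xs r t
∈-draws⁻ u {zero} (here refl) = refl , [] , λ ()
∈-draws⁻ {xs = xs} u {suc r} t∈
  with (y , ys) , p∈ , t∈′ ← ∈-concatMap⁻′ (λ p → map (proj₁ p ∷_) (draws (proj₂ p) r)) (picks xs) t∈
  with t′ , t′∈ , refl ← ∈-map⁻ (y ∷_) t∈′
  with xs↭ ← picks-↭ p∈
  with y∉ys ∷ uys ← Unique-resp-↭ xs↭ u
  with len , ut′ , t′⊆ys ← ∈-draws⁻ uys t′∈ =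
  cong suc len ,
  All.tabulate (λ z∈ y≡z → All.lookup y∉ys (t′⊆ys z∈) y≡z) ∷ ut′ ,
  λ { (here refl) → ↭.∈-resp-↭ (↭-sym xs↭) (here refl)
    ; (there z∈) → ↭.∈-resp-↭ (↭-sym xs↭) (there (t′⊆ys z∈)) }

∈-draws⁺ : Unique xs → ∀ {r t} → IsDraw xs r t → t ∈ draws xs r
∈-draws⁺ u {zero}  {[]}     _ = here refl
∈-draws⁺ u {suc r} {y ∷ t′} (len , y∉t′ ∷ ut′ , t⊆xs)
  with ys , p∈ ← ∈-picks (t⊆xs (here refl))
  with xs↭ ← picks-↭ p∈
  with _ ∷ uys ← Unique-resp-↭ xs↭ u =
  ∈-concatMap⁺′ (λ p → map (proj₁ p ∷_) (draws (proj₂ p) r)) p∈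
    (∈-map⁺ (y ∷_) (∈-draws⁺ uys (ℕ.suc-injective len , ut′ , t′⊆ys)))
  where
  t′⊆ys : t′ ⊆ ys
  t′⊆ys z∈ with ↭.∈-resp-↭ xs↭ (t⊆xs (there z∈))
  ... | here refl = ⊥-elim (All.lookup y∉t′ z∈ refl)
  ... | there z∈ys = z∈ys

Unique-draws : Unique xs → ∀ r → Unique (draws xs r)
Unique-draws u zero    = [] ∷ []
Unique-draws {xs = xs} u (suc r) =
  Unique-concatMap⁺ (λ p → map (proj₁ p ∷_) (draws (proj₂ p) r)) (just ∘ proj₁) head
    (λ z∈ → let _ , _ , z≡ = ∈-map⁻ _ z∈ in cong head z≡)
    (subst Unique (trans (cong (map just) (sym (map-proj₁-picks xs))) (sym (map-∘ (picks xs))))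
      (Unique.map⁺ (λ { refl → refl }) u))
    (λ p∈ → Unique.map⁺ (λ { refl → refl }) (Unique-draws (AllPairs.tail (Unique-resp-↭ (picks-↭ p∈) u)) r))

falling : ℕ → ℕ → ℕ
falling n       zero    = 1
falling zero    (suc r) = 0
falling (suc n) (suc r) = suc n * falling n r

falling-+ : ∀ n r s → falling n (r + s) ≡ falling n r * falling (n ∸ r) s
falling-+ n       zero    s = sym (+-identityʳ (falling n s))
falling-+ zero    (suc r) s = refl
falling-+ (suc n) (suc r) s =
  trans (cong (suc n *_) (falling-+ n r s)) (sym (*-assoc (suc n) (falling n r) _))

length-draws : ∀ (xs : List A) r → length (draws xs r) ≡ falling (length xs) r
length-draws xs       zero    = refl
length-draws []       (suc r) = refl
length-draws (x ∷ xs) (suc r) = begin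
  length (draws (x ∷ xs) (suc r))
    ≡⟨ length-concatMap-const (λ p → map (proj₁ p ∷_) (draws (proj₂ p) r)) length-block ⟩
  length (picks (x ∷ xs)) * falling (length xs) r
    ≡⟨ cong (_* falling (length xs) r) (trans (sym (length-map proj₁ (picks (x ∷ xs))))
                                               (cong length (map-proj₁-picks (x ∷ xs)))) ⟩
  falling (length (x ∷ xs)) (suc r) ∎
  where
  open ≡-Reasoning
  length-block : ∀ {p} → p ∈ picks (x ∷ xs) → length (map (proj₁ p ∷_) (draws (proj₂ p) r)) ≡ falling (length xs) r
  length-block {y , ys} p∈ = begin
    length (map (y ∷_) (draws ys r)) ≡⟨ length-map (y ∷_) (draws ys r) ⟩
    length (draws ys r)              ≡⟨ length-draws ys r ⟩
    falling (length ys) r            ≡⟨ cong (λ l → falling (ℕ.pred l) r) (↭.↭-length (↭-sym (picks-↭ p∈))) ⟩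
    falling (length xs) r            ∎

-- Distributions with equal weights

-- recip 0 = 0 is a junk value; it only ever weighs the outcomes of an empty distribution.
recip : ℕ → ℚ
recip zero    = 0ℚ
recip (suc n) = ℤ.+ 1 ℚ./ suc n

recip-* : ∀ a b → recip (a * b) ≡ recip a ℚ.* recip b
recip-* zero    b       = sym (ℚ.*-zeroˡ (recip b))
recip-* (suc a) zero    = trans (cong recip (*-zeroʳ a)) (sym (ℚ.*-zeroʳ (recip (suc a))))
recip-* (suc a) (suc b) = sym (begin
  recip (suc a) ℚ.* recip (suc b)                          ≡⟨ ℚ.fromℚᵘ-toℚᵘ _ ⟨
  ℚ.fromℚᵘ (ℚ.toℚᵘ (recip (suc a) ℚ.* recip (suc b)))       ≡⟨ ℚ.fromℚᵘ-cong (ℚᵘ.≃-trans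
                                                                 (ℚ.toℚᵘ-homo-* (recip (suc a)) (recip (suc b)))
                                                                 (ℚᵘ.*-cong (ℚ.toℚᵘ-fromℚᵘ (ℚᵘ.mkℚᵘ (ℤ.+ 1) a))
                                                                             (ℚ.toℚᵘ-fromℚᵘ (ℚᵘ.mkℚᵘ (ℤ.+ 1) b)))) ⟩
  recip (suc a * suc b)                                    ∎)
  where open ≡-Reasoning

recip-falling-+ : ∀ n r s → recip (falling n r) ℚ.* recip (falling (n ∸ r) s) ≡ recip (falling n (r + s))
recip-falling-+ n r s = trans (sym (recip-* (falling n r) _)) (cong recip (sym (falling-+ n r s)))

support : Dist A → List A
support = map proj₂

support->>= : (d : Dist A) (f : A → Dist B) → support (d >>= f) ≡ concatMap (support ∘ f ∘ proj₂) d
support->>= d f = trans (map-concatMap proj₂ _ d) (concatMap-cong (λ e → sym (map-∘ (f (proj₂ e)))) d)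

support-uniform : (xs : List A) → support (uniform xs) ≡ xs
support-uniform []       = refl
support-uniform (x ∷ xs) = trans (sym (map-∘ (x ∷ xs))) (map-id (x ∷ xs))

support-uniform->>= : (xs : List A) (f : A → Dist B) → support (uniform xs >>= f) ≡ concatMap (support ∘ f) xs
support-uniform->>= xs f = begin
  support (uniform xs >>= f)                   ≡⟨ support->>= (uniform xs) f ⟩
  concatMap (support ∘ f ∘ proj₂) (uniform xs) ≡⟨ concatMap-map (support ∘ f) proj₂ (uniform xs) ⟨
  concatMap (support ∘ f) (support (uniform xs)) ≡⟨ cong (concatMap (support ∘ f)) (support-uniform xs) ⟩
  concatMap (support ∘ f) xs                   ∎
  where open ≡-Reasoning

support->>=-return : (d : Dist A) (g : A → B) → support (d >>= (return ∘ g)) ≡ map g (support d)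
support->>=-return []      g = refl
support->>=-return (e ∷ d) g = cong (g (proj₂ e) ∷_) (support->>=-return d g)

Flat : Dist A → ℚ → Set
Flat d w = All ((_≡ w) ∘ proj₁) d

Flat-return : (x : A) → Flat (return x) 1ℚ
Flat-return x = refl ∷ []

Flat-uniform : (xs : List A) → Flat (uniform xs) (recip (length xs))
Flat-uniform []       = []
Flat-uniform (x ∷ xs) = All.map⁺ (All.universal (λ _ → refl) (x ∷ xs))

Flat->>= : {d : Dist A} {f : A → Dist B} {w v : ℚ} →
           Flat d w → (∀ {x} → x ∈ support d → Flat (f x) v) → Flat (d >>= f) (w ℚ.* v)
Flat->>= {d = []}           []            flat-f = []
Flat->>= {d = (p , x) ∷ d} (refl ∷ flat-d) flat-f =
  All.++⁺ (All.map⁺ (All.map (cong (p ℚ.*_)) (flat-f (here refl)))) (Flat->>= flat-d (flat-f ∘ there))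

Flat->>=-return : {d : Dist A} {w : ℚ} (g : A → B) → Flat d w → Flat (d >>= (return ∘ g)) w
Flat->>=-return {w = w} g flat-d =
  subst (Flat _) (ℚ.*-identityʳ w) (Flat->>= flat-d (λ _ → Flat-return _))

count : Matrix k → List (Matrix k) → ℕ
count M = length ∘ filter (λ X → ≡-dec (≡-dec ℕ._≟_) X M)

probOf-Flat : {d : Dist (Matrix k)} {w : ℚ} (M : Matrix k) → Flat d w → probOf d M ≡ count M (support d) · w
probOf-Flat         M []                  = refl
probOf-Flat {d = (p , X) ∷ d} M (refl ∷ flat-d) with ≡-dec (≡-dec ℕ._≟_) X M
... | yes _ = cong (p ℚ.+_) (probOf-Flat M flat-d)
... | no  _ = probOf-Flat M flat-d

probOf-cong : {d d′ : Dist (Matrix k)} {w : ℚ} → Flat d w → Flat d′ w → support d ↭ support d′ →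
              ∀ M → probOf d M ≡ probOf d′ M
probOf-cong {d = d} {d′} {w} flat-d flat-d′ d↭d′ M = begin
  probOf d M               ≡⟨ probOf-Flat M flat-d ⟩
  count M (support d) · w  ≡⟨ cong (_· w) (↭.↭-length (↭.filter-↭ _ d↭d′)) ⟩
  count M (support d′) · w ≡⟨ probOf-Flat M flat-d′ ⟨
  probOf d′ M              ∎
  where open ≡-Reasoning

-- The batch procedure and the pair sampler

module _ {n k : ℕ} (st : Fin n → Fin k) where
  open Population st
  open import Data.List.Membership.DecPropositional (_≟_ {n}) using (_∈?_)

  private
    agents : List (Fin n)
    agents = List.allFin n

    Unique-agents : Unique agents
    Unique-agents = Unique.allFin⁺ n

    ⊆agents : ∀ {s} → s ⊆ agents
    ⊆agents {x = z} _ = ∈-allFin z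

    length-agents : length agents ≡ n
    length-agents = length-tabulate id

  module _ {R s : List (Fin n)} where

    ∈-remove⁻ : ∀ {z} → z ∈ remove R s → z ∈ R × z ∉ s
    ∈-remove⁻ = ∈-filter⁻ (λ a → ¬? (a ∈? s))

    ∈-remove⁺ : ∀ {z} → z ∈ R → z ∉ s → z ∈ remove R s
    ∈-remove⁺ = ∈-filter⁺ (λ a → ¬? (a ∈? s))

    Unique-remove : Unique R → Unique (remove R s)
    Unique-remove = Unique.filter⁺ (λ a → ¬? (a ∈? s))

    length-remove : Unique R → Unique s → s ⊆ R → length (remove R s) ≡ length R ∸ length s
    length-remove uR us s⊆R = begin
      length (remove R s)                           ≡⟨ m+n∸m≡n (length s) _ ⟨
      length s + length (remove R s) ∸ length s     ≡⟨ cong (_∸ length s) (length-++ s) ⟨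
      length (s ++ remove R s) ∸ length s           ≡⟨ cong (_∸ length s) (↭.↭-length R↭) ⟨
      length R ∸ length s                           ∎
      where
      open ≡-Reasoning
      R⊆ : R ⊆ s ++ remove R s
      R⊆ {z} z∈R with z ∈? s
      ... | yes z∈s = ∈-++⁺ˡ z∈s
      ... | no  z∉s = ∈-++⁺ʳ s (∈-remove⁺ z∈R z∉s)
      R↭ : R ↭ s ++ remove R s
      R↭ = unique∧set⇒↭ uR (Unique.++⁺ us (Unique-remove uR) (λ (z∈s , z∈rest) → proj₂ (∈-remove⁻ z∈rest) z∈s))
             R⊆ (λ z∈ → [ s⊆R , proj₁ ∘ ∈-remove⁻ ]′ (∈-++⁻ s z∈))

  successiveDraws : ∀ {l} → Vec ℕ l → List (Fin n) → List (Vec (List (Fin n)) l)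
  successiveDraws []      R = [] ∷ []
  successiveDraws (d ∷ D) R = concatMap (λ s → map (s ∷_) (successiveDraws D (remove R s))) (draws R d)

  IsSuccessiveDraw : ∀ {l} → Vec ℕ l → List (Fin n) → Vec (List (Fin n)) l → Set
  IsSuccessiveDraw D R v = Vec.map length v ≡ D × Unique (flatten v) × flatten v ⊆ R

  ∈-successiveDraws⁻ : ∀ {l} (D : Vec ℕ l) {R} → Unique R → ∀ {v} → v ∈ successiveDraws D R → IsSuccessiveDraw D R v
  ∈-successiveDraws⁻ []      uR (here refl) = refl , [] , λ ()
  ∈-successiveDraws⁻ (d ∷ D) {R} uR v∈
    with s , s∈ , v∈′ ← ∈-concatMap⁻′ (λ s → map (s ∷_) (successiveDraws D (remove R s))) (draws R d) v∈
    with v′ , v′∈ , refl ← ∈-map⁻ (s ∷_) v∈′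
    with len , us , s⊆R ← ∈-draws⁻ uR s∈
    with lens , uv′ , v′⊆ ← ∈-successiveDraws⁻ D (Unique-remove uR) v′∈ =
    cong₂ _∷_ len lens ,
    Unique.++⁺ us uv′ (λ (z∈s , z∈v′) → proj₂ (∈-remove⁻ {R} (v′⊆ z∈v′)) z∈s) ,
    λ z∈ → [ s⊆R , proj₁ ∘ ∈-remove⁻ {R} ∘ v′⊆ ]′ (∈-++⁻ s z∈)

  ∈-successiveDraws⁺ : ∀ {l} (D : Vec ℕ l) {R} → Unique R → ∀ {v} → IsSuccessiveDraw D R v → v ∈ successiveDraws D R
  ∈-successiveDraws⁺ []      uR {[]}     _                 = here refl
  ∈-successiveDraws⁺ (d ∷ D) {R} uR {s ∷ v′} (lens , u , ⊆R)
    with us , uv′ , s#v′ ← Unique-++⁻ s u =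
    ∈-concatMap⁺′ (λ s → map (s ∷_) (successiveDraws D (remove R s)))
      (∈-draws⁺ uR (∷-injectiveˡ lens , us , ⊆R ∘ ∈-++⁺ˡ))
      (∈-map⁺ (s ∷_) (∈-successiveDraws⁺ D (Unique-remove uR)
        (∷-injectiveʳ lens , uv′ , λ z∈ → ∈-remove⁺ (⊆R (∈-++⁺ʳ s z∈)) (λ z∈s → s#v′ (z∈s , z∈)))))

  Unique-successiveDraws : ∀ {l} (D : Vec ℕ l) {R} → Unique R → Unique (successiveDraws D R)
  Unique-successiveDraws []      uR = [] ∷ []
  Unique-successiveDraws (d ∷ D) {R} uR =
    Unique-concatMap⁺ (λ s → map (s ∷_) (successiveDraws D (remove R s))) (λ s → s) Vec.head
      (λ z∈ → let _ , _ , z≡ = ∈-map⁻ _ z∈ in cong Vec.head z≡)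
      (subst Unique (sym (map-id (draws R d))) (Unique-draws uR d))
      (λ _ → Unique.map⁺ ∷-injectiveʳ (Unique-successiveDraws D (Unique-remove uR)))

  support-rowsStep : ∀ {l} (D : Vec ℕ l) R → support (rowsStep D R) ≡ map (Vec.map countVec) (successiveDraws D R)
  support-rowsStep []      R = refl
  support-rowsStep (d ∷ D) R = begin
    support (rowsStep (d ∷ D) R)
      ≡⟨ support-uniform->>= (draws R d) _ ⟩
    concatMap (λ s → support (rowsStep D (remove R s) >>= (return ∘ (countVec s ∷_)))) (draws R d)
      ≡⟨ concatMap-cong block (draws R d) ⟩
    concatMap (λ s → map (Vec.map countVec) (map (s ∷_) (successiveDraws D (remove R s)))) (draws R d)
      ≡⟨ map-concatMap (Vec.map countVec) _ (draws R d) ⟨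
    map (Vec.map countVec) (successiveDraws (d ∷ D) R) ∎
    where
    open ≡-Reasoning
    block : ∀ s → support (rowsStep D (remove R s) >>= (return ∘ (countVec s ∷_)))
                  ≡ map (Vec.map countVec) (map (s ∷_) (successiveDraws D (remove R s)))
    block s = begin
      support (rowsStep D (remove R s) >>= (return ∘ (countVec s ∷_)))
        ≡⟨ support->>=-return (rowsStep D (remove R s)) _ ⟩
      map (countVec s ∷_) (support (rowsStep D (remove R s)))
        ≡⟨ cong (map (countVec s ∷_)) (support-rowsStep D (remove R s)) ⟩
      map (countVec s ∷_) (map (Vec.map countVec) (successiveDraws D (remove R s)))
        ≡⟨ map-∘ _ ⟨
      map (λ v → countVec s ∷ Vec.map countVec v) (successiveDraws D (remove R s))
        ≡⟨ map-∘ _ ⟩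
      map (Vec.map countVec) (map (s ∷_) (successiveDraws D (remove R s))) ∎

  Flat-rowsStep : ∀ {l} (D : Vec ℕ l) {R} → Unique R → Flat (rowsStep D R) (recip (falling (length R) (Vec.sum D)))
  Flat-rowsStep []      uR = Flat-return []
  Flat-rowsStep (d ∷ D) {R} uR =
    subst (Flat (rowsStep (d ∷ D) R)) weight
      (Flat->>= (Flat-uniform (draws R d)) block)
    where
    block : ∀ {s} → s ∈ support (uniform (draws R d)) →
            Flat (rowsStep D (remove R s) >>= (return ∘ (countVec s ∷_))) (recip (falling (length R ∸ d) (Vec.sum D)))
    block {s} s∈ with len , us , s⊆R ← ∈-draws⁻ uR {d} (subst (s ∈_) (support-uniform (draws R d)) s∈) =
      Flat->>=-return (countVec s ∷_)
        (subst (λ L → Flat (rowsStep D (remove R s)) (recip (falling L (Vec.sum D))))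
          (trans (length-remove uR us s⊆R) (cong (length R ∸_) len))
          (Flat-rowsStep D (Unique-remove uR)))
    weight : recip (length (draws R d)) ℚ.* recip (falling (length R ∸ d) (Vec.sum D))
             ≡ recip (falling (length R) (d + Vec.sum D))
    weight = trans (cong (λ L → recip L ℚ.* recip (falling (length R ∸ d) (Vec.sum D))) (length-draws R d))
                   (recip-falling-+ (length R) d (Vec.sum D))

  countVec-buckets : ∀ s → countVec s ≡ Vec.map length (buckets st s)
  countVec-buckets s = lookup-ext λ j → begin
    lookup (countVec s) j                     ≡⟨ lookup∘tabulate _ j ⟩
    length (filter ((_≟ j) ∘ st) s)           ≡⟨ cong length (lookup-buckets st s j) ⟨
    length (lookup (buckets st s) j)          ≡⟨ lookup-map j length (buckets st s) ⟨
    lookup (Vec.map length (buckets st s)) j  ∎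
    where open ≡-Reasoning

  sum-countVec : ∀ s → Vec.sum (countVec s) ≡ length s
  sum-countVec s = begin
    Vec.sum (countVec s)                      ≡⟨ cong Vec.sum (countVec-buckets s) ⟩
    Vec.sum (Vec.map length (buckets st s))   ≡⟨ sum-map-length (buckets st s) ⟩
    length (flatten (buckets st s))           ≡⟨ ↭.↭-length (flatten-buckets st s) ⟩
    length s                                  ∎
    where open ≡-Reasoning

  countVec-∷ : ∀ x s → countVec (x ∷ s) ≡ countVec s [ st x ]%= suc
  countVec-∷ x s = begin
    countVec (x ∷ s)                                        ≡⟨ countVec-buckets (x ∷ s) ⟩
    Vec.map length (buckets st s [ st x ]%= (x ∷_))         ≡⟨ map-updateAt (buckets st s) (st x) refl ⟩
    Vec.map length (buckets st s) [ st x ]%= suc            ≡⟨ cong (_[ st x ]%= suc) (countVec-buckets s) ⟨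
    countVec s [ st x ]%= suc                               ∎
    where open ≡-Reasoning

  procedureDraws : ℕ → List (List (Fin n) × Vec (List (Fin n)) k)
  procedureDraws m =
    concatMap (λ s → map (s ,_) (successiveDraws (countVec s) (remove agents s))) (draws agents m)

  rowCounts : List (Fin n) × Vec (List (Fin n)) k → Matrix k
  rowCounts = Vec.map countVec ∘ proj₂

  support-procedure : ∀ m → support (procedure m) ≡ map rowCounts (procedureDraws m)
  support-procedure m = begin
    support (procedure m)
      ≡⟨ support-uniform->>= (draws agents m) _ ⟩
    concatMap (λ s → support (rowsStep (countVec s) (remove agents s))) (draws agents m)
      ≡⟨ concatMap-cong (λ s → trans (support-rowsStep (countVec s) _) (map-∘ _)) (draws agents m) ⟩
    concatMap (λ s → map rowCounts (map (s ,_) (successiveDraws (countVec s) (remove agents s))))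
              (draws agents m)
      ≡⟨ map-concatMap rowCounts _ (draws agents m) ⟨
    map rowCounts (procedureDraws m) ∎
    where open ≡-Reasoning

  Flat-procedure : ∀ m → Flat (procedure m) (recip (falling n (m + m)))
  Flat-procedure m = subst (Flat (procedure m)) weight (Flat->>= (Flat-uniform (draws agents m)) block)
    where
    block : ∀ {s} → s ∈ support (uniform (draws agents m)) →
            Flat (rowsStep (countVec s) (remove agents s)) (recip (falling (n ∸ m) m))
    block {s} s∈ with len , us , _ ← ∈-draws⁻ Unique-agents {m} (subst (s ∈_) (support-uniform _) s∈) =
      subst (Flat _) (cong₂ (λ L r → recip (falling L r))
                        (trans (length-remove Unique-agents us ⊆agents)
                               (cong₂ _∸_ length-agents len))
                        (trans (sum-countVec s) len))
        (Flat-rowsStep (countVec s) (Unique-remove Unique-agents))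
    weight : recip (length (draws agents m)) ℚ.* recip (falling (n ∸ m) m) ≡ recip (falling n (m + m))
    weight = trans (cong (λ L → recip L ℚ.* recip (falling (n ∸ m) m))
                         (trans (length-draws agents m) (cong (λ L → falling L m) length-agents)))
                   (recip-falling-+ n m m)

  support-pairsDist : ∀ m → support (pairsDist m) ≡ map pairMatrix (draws agents (2 * m))
  support-pairsDist m =
    trans (support->>=-return (uniform (draws agents (2 * m))) pairMatrix)
          (cong (map pairMatrix) (support-uniform (draws agents (2 * m))))

  Flat-pairsDist : ∀ m → Flat (pairsDist m) (recip (falling n (m + m)))
  Flat-pairsDist m =
    subst (λ L → Flat (pairsDist m) (recip L))
      (trans (length-draws agents (2 * m)) (cong₂ falling length-agents (cong (m +_) (+-identityʳ m))))
      (Flat->>=-return pairMatrix (Flat-uniform (draws agents (2 * m))))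

  respondersByState : List (Fin n × Fin n) → Vec (List (Fin n)) k
  respondersByState P = Vec.map (map proj₂) (buckets (st ∘ proj₁) P)

  lookup-respondersByState : ∀ P i → lookup (respondersByState P) i ≡ map proj₂ (filter ((_≟ i) ∘ st ∘ proj₁) P)
  lookup-respondersByState P i =
    trans (lookup-map i (map proj₂) (buckets (st ∘ proj₁) P)) (cong (map proj₂) (lookup-buckets (st ∘ proj₁) P i))

  respondersByState-∷ : ∀ x y P → respondersByState ((x , y) ∷ P) ≡ respondersByState P [ st x ]%= (y ∷_)
  respondersByState-∷ x y P = map-updateAt (buckets (st ∘ proj₁) P) (st x) refl

  flatten-respondersByState : ∀ P → flatten (respondersByState P) ↭ map proj₂ P
  flatten-respondersByState P = begin
    flatten (respondersByState P)                  ≡⟨ cong List.concat (toList-map (map proj₂) (buckets (st ∘ proj₁) P)) ⟩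
    List.concat (map (map proj₂) (Vec.toList (buckets (st ∘ proj₁) P)))
                                                   ≡⟨ List.concat-map (Vec.toList (buckets (st ∘ proj₁) P)) ⟩
    map proj₂ (flatten (buckets (st ∘ proj₁) P))   ↭⟨ ↭.map⁺ proj₂ (flatten-buckets (st ∘ proj₁) P) ⟩
    map proj₂ P                                    ∎
    where open PermutationReasoning

  map-length-respondersByState : ∀ P → Vec.map length (respondersByState P) ≡ countVec (map proj₁ P)
  map-length-respondersByState P = lookup-ext λ i → begin
    lookup (Vec.map length (respondersByState P)) i      ≡⟨ lookup-map i length (respondersByState P) ⟩
    length (lookup (respondersByState P) i)              ≡⟨ cong length (lookup-respondersByState P i) ⟩
    length (map proj₂ (filter ((_≟ i) ∘ st ∘ proj₁) P))  ≡⟨ length-map proj₂ (filter ((_≟ i) ∘ st ∘ proj₁) P) ⟩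
    length (filter ((_≟ i) ∘ st ∘ proj₁) P)              ≡⟨ length-map proj₁ (filter ((_≟ i) ∘ st ∘ proj₁) P) ⟨
    length (map proj₁ (filter ((_≟ i) ∘ st ∘ proj₁) P))  ≡⟨ cong length (filter-map ((_≟ i) ∘ st) proj₁ P) ⟨
    length (filter ((_≟ i) ∘ st) (map proj₁ P))          ≡⟨ lookup∘tabulate _ i ⟨
    lookup (countVec (map proj₁ P)) i                    ∎
    where open ≡-Reasoning

  split : List (Fin n × Fin n) → List (Fin n) × Vec (List (Fin n)) k
  split P = map proj₁ P , respondersByState P

  rowCounts-split-pairs : ∀ a → rowCounts (split (pairs a)) ≡ pairMatrix a
  rowCounts-split-pairs a = lookup-ext λ i → begin
    lookup (Vec.map countVec (respondersByState P)) i  ≡⟨ lookup-map i countVec (respondersByState P) ⟩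
    countVec (lookup (respondersByState P) i)          ≡⟨ cong countVec (lookup-respondersByState P i) ⟩
    countVec (map proj₂ (filter (initiatorIn i) P))    ≡⟨ tabulate-cong (entry i) ⟩
    tabulate (λ j → length (filter (initiatorIn i) (filter (responderIn j) P))) ≡⟨ lookup∘tabulate _ i ⟨
    lookup (pairMatrix a) i                            ∎
    where
    open ≡-Reasoning
    P = pairs a
    initiatorIn : (i : Fin k) (p : Fin n × Fin n) → Dec (st (proj₁ p) ≡ i)
    responderIn : (j : Fin k) (p : Fin n × Fin n) → Dec (st (proj₂ p) ≡ j)
    initiatorIn i = (_≟ i) ∘ st ∘ proj₁
    responderIn j = (_≟ j) ∘ st ∘ proj₂
    entry : ∀ i j → length (filter ((_≟ j) ∘ st) (map proj₂ (filter (initiatorIn i) P)))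
                    ≡ length (filter (initiatorIn i) (filter (responderIn j) P))
    entry i j = begin
      length (filter ((_≟ j) ∘ st) (map proj₂ (filter (initiatorIn i) P)))
        ≡⟨ cong length (filter-map ((_≟ j) ∘ st) proj₂ (filter (initiatorIn i) P)) ⟩
      length (map proj₂ (filter (responderIn j) (filter (initiatorIn i) P)))
        ≡⟨ length-map proj₂ (filter (responderIn j) (filter (initiatorIn i) P)) ⟩
      length (filter (responderIn j) (filter (initiatorIn i) P))
        ≡⟨ cong length (filter-comm (responderIn j) (initiatorIn i) P) ⟩
      length (filter (initiatorIn i) (filter (responderIn j) P)) ∎

  split-injective : ∀ P P′ → split P ≡ split P′ → P ≡ P′
  split-injective []             []                 eq = refl
  split-injective ((x , y) ∷ P) ((x′ , y′) ∷ P′) eq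
    with refl ← List.∷-injectiveˡ (cong proj₁ eq)
    with refl , R≡R′ ← []%=∷-injective (respondersByState P) (respondersByState P′) (st x)
                          (trans (sym (respondersByState-∷ x y P))
                                 (trans (cong proj₂ eq) (respondersByState-∷ x y′ P′))) =
    cong ((x , y) ∷_) (split-injective P P′ (cong₂ _,_ (List.∷-injectiveʳ (cong proj₁ eq)) R≡R′))

  map-length-dropHead : ∀ {x s} {v : Vec (List (Fin n)) k} {y ys} →
                        Vec.map length v ≡ countVec (x ∷ s) → lookup v (st x) ≡ y ∷ ys →
                        Vec.map length (v [ st x ]≔ ys) ≡ countVec s
  map-length-dropHead {x} {s} {v} {y} {ys} lens v[x] = begin
    Vec.map length (v [ st x ]≔ ys)                  ≡⟨ map-updateAt v (st x) refl ⟩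
    Vec.map length v [ st x ]≔ length ys             ≡⟨ cong (_[ st x ]≔ length ys) (trans lens (countVec-∷ x s)) ⟩
    countVec s [ st x ]%= suc [ st x ]≔ length ys    ≡⟨ updateAt-updateAt (st x) (countVec s) ⟩
    countVec s [ st x ]≔ length ys                   ≡⟨ cong (countVec s [ st x ]≔_) length-ys ⟩
    countVec s [ st x ]≔ lookup (countVec s) (st x)  ≡⟨ []≔-lookup (countVec s) (st x) ⟩
    countVec s                                       ∎
    where
    open ≡-Reasoning
    length-ys : length ys ≡ lookup (countVec s) (st x)
    length-ys = ℕ.suc-injective (begin
      length (y ∷ ys)                                ≡⟨ cong length v[x] ⟨
      length (lookup v (st x))                       ≡⟨ length-lookup (trans lens (countVec-∷ x s)) (st x) ⟩
      lookup (countVec s [ st x ]%= suc) (st x)      ≡⟨ lookup∘updateAt (st x) (countVec s) ⟩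
      suc (lookup (countVec s) (st x))               ∎)

  split-surjective : ∀ s {v} → Vec.map length v ≡ countVec s → ∃[ P ] split P ≡ (s , v)
  split-surjective []      {v} lens = [] , cong ([] ,_) (lookup-ext λ i →
    trans (lookup-respondersByState [] i) (sym (length≡0⇒[] (trans (length-lookup lens i) (lookup∘tabulate _ i)))))
  split-surjective (x ∷ s) {v} lens with lookup v (st x) in v[x]
  ... | []     with () ← trans (cong length (sym v[x]))
                               (trans (length-lookup (trans lens (countVec-∷ x s)) (st x))
                                      (lookup∘updateAt (st x) (countVec s)))
  ... | y ∷ ys with P , split-P ← split-surjective s {v [ st x ]≔ ys} (map-length-dropHead lens v[x]) =
    (x , y) ∷ P , cong₂ _,_ (cong (x ∷_) (cong proj₁ split-P)) (begin
      respondersByState ((x , y) ∷ P)            ≡⟨ respondersByState-∷ x y P ⟩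
      respondersByState P [ st x ]%= (y ∷_)      ≡⟨ cong (_[ st x ]%= (y ∷_)) (cong proj₂ split-P) ⟩
      v [ st x ]≔ ys [ st x ]%= (y ∷_)           ≡⟨ updateAt-updateAt (st x) v ⟩
      v [ st x ]≔ (y ∷ ys)                       ≡⟨ cong (v [ st x ]≔_) v[x] ⟨
      v [ st x ]≔ lookup v (st x)                ≡⟨ []≔-lookup v (st x) ⟩
      v                                          ∎)
    where open ≡-Reasoning

  pairs-unpairs : ∀ P → pairs (unpairs P) ≡ P
  pairs-unpairs []            = refl
  pairs-unpairs ((x , y) ∷ P) = cong ((x , y) ∷_) (pairs-unpairs P)

  unpairs-pairs : ∀ m a → length a ≡ m + m → unpairs (pairs a) ≡ a
  unpairs-pairs zero    []          _   = refl
  unpairs-pairs (suc m) (x ∷ [])    len with () ← trans (ℕ.suc-injective len) (+-suc m m)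
  unpairs-pairs (suc m) (x ∷ y ∷ a) len =
    cong (λ a′ → x ∷ y ∷ a′) (unpairs-pairs m a (ℕ.suc-injective (trans (ℕ.suc-injective len) (+-suc m m))))

  length-pairs : ∀ m a → length a ≡ m + m → length (pairs a) ≡ m
  length-pairs zero    []          _   = refl
  length-pairs (suc m) (x ∷ [])    len with () ← trans (ℕ.suc-injective len) (+-suc m m)
  length-pairs (suc m) (x ∷ y ∷ a) len =
    cong suc (length-pairs m a (ℕ.suc-injective (trans (ℕ.suc-injective len) (+-suc m m))))

  ∈-procedureDraws⁻ : ∀ {m s v} → (s , v) ∈ procedureDraws m →
                      IsDraw agents m s × IsSuccessiveDraw (countVec s) (remove agents s) v
  ∈-procedureDraws⁻ {m} p∈
    with s , s∈ , p∈′ ← ∈-concatMap⁻′ _ (draws agents m) p∈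
    with v , v∈ , refl ← ∈-map⁻ (s ,_) p∈′ =
    ∈-draws⁻ Unique-agents s∈ , ∈-successiveDraws⁻ (countVec s) (Unique-remove Unique-agents) v∈

  ∈-procedureDraws⁺ : ∀ {m s v} → IsDraw agents m s →
                      IsSuccessiveDraw (countVec s) (remove agents s) v → (s , v) ∈ procedureDraws m
  ∈-procedureDraws⁺ {s = s} s-draw v-draw =
    ∈-concatMap⁺′ (λ s → map (s ,_) (successiveDraws (countVec s) (remove agents s)))
      (∈-draws⁺ Unique-agents s-draw) (∈-map⁺ (s ,_) (∈-successiveDraws⁺ (countVec s) (Unique-remove Unique-agents) v-draw))

  split-pairs-∈ : ∀ m {a} → a ∈ draws agents (m + m) → split (pairs a) ∈ procedureDraws m
  split-pairs-∈ m {a} a∈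
    with len , ua , _ ← ∈-draws⁻ Unique-agents a∈
    with us , ur , s#r ← Unique-++⁻ (map proj₁ (pairs a))
           (Unique-resp-↭ (unpairs-↭ (pairs a)) (subst Unique (sym (unpairs-pairs m a len)) ua)) =
    ∈-procedureDraws⁺
      (trans (length-map proj₁ (pairs a)) (length-pairs m a len) , us , ⊆agents)
      (map-length-respondersByState (pairs a) ,
       Unique-resp-↭ (↭-sym (flatten-respondersByState (pairs a))) ur ,
       λ z∈ → ∈-remove⁺ (∈-allFin _) λ z∈s → s#r (z∈s , ↭.∈-resp-↭ (flatten-respondersByState (pairs a)) z∈))

  ∈-procedureDraws⇒∈-split-pairs : ∀ m {p} → p ∈ procedureDraws m → p ∈ map (split ∘ pairs) (draws agents (m + m))
  ∈-procedureDraws⇒∈-split-pairs m {s , v} p∈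
    with (len , us , _) , (lens , uv , v⊆) ← ∈-procedureDraws⁻ {m} p∈
    with P , refl ← split-surjective s lens =
    subst (_∈ map (split ∘ pairs) (draws agents (m + m))) (cong split (pairs-unpairs P))
      (∈-map⁺ (split ∘ pairs) (∈-draws⁺ Unique-agents (length-unpairs′ , unique-unpairs , ⊆agents)))
    where
    length-unpairs′ : length (unpairs P) ≡ m + m
    length-unpairs′ = trans (length-unpairs P) (cong (λ l → l + l) (trans (sym (length-map proj₁ P)) len))
    unique-unpairs : Unique (unpairs P)
    unique-unpairs = Unique-resp-↭ (↭-sym (unpairs-↭ P))
      (Unique.++⁺ us (Unique-resp-↭ (flatten-respondersByState P) uv)
        λ (z∈s , z∈r) → proj₂ (∈-remove⁻ {agents} (v⊆ (↭.∈-resp-↭ (↭-sym (flatten-respondersByState P)) z∈r))) z∈s)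

  Unique-procedureDraws : ∀ m → Unique (procedureDraws m)
  Unique-procedureDraws m =
    Unique-concatMap⁺ (λ s → map (s ,_) (successiveDraws (countVec s) (remove agents s))) (λ s → s) proj₁
      (λ z∈ → let _ , _ , z≡ = ∈-map⁻ _ z∈ in cong proj₁ z≡)
      (subst Unique (sym (map-id _)) (Unique-draws Unique-agents m))
      (λ {s} _ → Unique.map⁺ (cong proj₂) (Unique-successiveDraws (countVec s) (Unique-remove Unique-agents)))

  Unique-split-pairs : ∀ m → Unique (map (split ∘ pairs) (draws agents (m + m)))
  Unique-split-pairs m = Unique-map⁺ (split ∘ pairs) injective (Unique-draws Unique-agents (m + m))
    where
    unpairs-pairs′ : ∀ {a} → a ∈ draws agents (m + m) → unpairs (pairs a) ≡ a
    unpairs-pairs′ {a} a∈ = unpairs-pairs m a (proj₁ (∈-draws⁻ Unique-agents a∈))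
    injective : ∀ {a a′} → a ∈ draws agents (m + m) → a′ ∈ draws agents (m + m) →
                split (pairs a) ≡ split (pairs a′) → a ≡ a′
    injective a∈ a′∈ eq =
      trans (sym (unpairs-pairs′ a∈)) (trans (cong unpairs (split-injective _ _ eq)) (unpairs-pairs′ a′∈))

  procedureDraws-↭ : ∀ m → procedureDraws m ↭ map (split ∘ pairs) (draws agents (m + m))
  procedureDraws-↭ m =
    unique∧set⇒↭ (Unique-procedureDraws m) (Unique-split-pairs m) (∈-procedureDraws⇒∈-split-pairs m) image⊆
    where
    image⊆ : map (split ∘ pairs) (draws agents (m + m)) ⊆ procedureDraws m
    image⊆ p∈ with a , a∈ , refl ← ∈-map⁻ (split ∘ pairs) p∈ = split-pairs-∈ m a∈

  support-procedure-↭ : ∀ m → support (procedure m) ↭ support (pairsDist m)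
  support-procedure-↭ m = begin
    support (procedure m)                                              ≡⟨ support-procedure m ⟩
    map rowCounts (procedureDraws m)                                   ↭⟨ ↭.map⁺ rowCounts (procedureDraws-↭ m) ⟩
    map rowCounts (map (split ∘ pairs) (draws agents (m + m))) ≡⟨ map-∘ _ ⟨
    map (rowCounts ∘ split ∘ pairs) (draws agents (m + m))    ≡⟨ List.map-cong rowCounts-split-pairs _ ⟩
    map pairMatrix (draws agents (m + m))                     ≡⟨ cong (map pairMatrix ∘ draws agents)
                                                                                (cong (m +_) (+-identityʳ m)) ⟨
    map pairMatrix (draws agents (2 * m))                     ≡⟨ support-pairsDist m ⟨
    support (pairsDist m)                                              ∎
    where open PermutationReasoning

lemma13 : (n k : ℕ) (st : Fin n → Fin k) (m : ℕ) → 2 * m ≤ n →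
          (M : Matrix k) →
          probOf (Population.procedure st m) M ≡ probOf (Population.pairsDist st m) M
lemma13 n k st m _ = probOf-cong (Flat-procedure st m) (Flat-pairsDist st m) (support-procedure-↭ st m)
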